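{- For $n\ge 0$ let $\mathrm{WI}_n$ be the number of $\Pi\in S^3_n$ whose vector of levels $(\mathrm{lev}(\Pi_1),\dots,\mathrm{lev}(\Pi_n))$ is weakly increasing, where $\mathrm{lev}$ is the maximal-entry level (defined in the context). Then \[\sum_{n\ge 0}\frac{\mathrm{WI}_n}{n!}x^n=\frac{1}{\cos(x)-\sin(x)}.\]
   Context: For $n\ge1$, $S_n$ denotes the set of permutations of $\{0,1,\dots,n-1\}$ written in one-line notation $\pi=\pi_1\pi_2\cdots\pi_n$. For $d\ge 2$, a $d$-dimensional permutation of length $n$ is an ordered $(d-1)$-tuple $\Pi=(\pi^2,\dots,\pi^d)$ with each $\pi^i=\pi^i_1\cdots\pi^i_n\in S_n$; $S^d_n$ denotes the set of these (for $n=0$ it consists of the single empty permutation). The elements of $\Pi$ are the columns $\Pi_j=(\pi^2_j,\pi^3_j,\dots,\pi^d_j)^T$, $1\le j\le n$. The level of an element is $\mathrm{lev}(\Pi_j)=\max\{\pi^2_j,\dots,\pi^d_j\}$ (the maximal entry of the column). -}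

module Defs where

open import Data.Nat as ℕ using (ℕ; zero; suc; _⊔_; _≤?_; _∸_; _!)
open import Data.Nat.Properties using (_!≢0)
open import Data.Fin using (Fin; toℕ)
open import Data.Fin.Properties using (_≟_)
open import Data.Vec as Vec using (Vec; []; _∷_; toList; zipWith)
open import Data.List as List using (List; []; _∷_; [_]; concatMap; allFin; filter; length; cartesianProduct)
import Data.List.Relation.Unary.Unique.DecPropositional as UDP
open import Data.List.Relation.Unary.Linked using (linked?)
open import Data.Product using (_×_; _,_)
open import Data.Integer as ℤ using (ℤ; +_; -[1+_])
open import Data.Rational as ℚ using (ℚ; _/_; 0ℚ; 1ℚ)

-- Permutations of {0,…,n-1} in one-line notation: length-n words over
-- Fin n with pairwise distinct entries.

words : (n k : ℕ) → List (Vec (Fin k) n)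
words zero    k = [ [] ]
words (suc n) k = concatMap (λ i → List.map (i ∷_) (words n k)) (allFin k)

Perms : (n : ℕ) → List (Vec (Fin n) n)
Perms n = filter (λ v → UDP.unique? (_≟_ {n}) (toList v)) (words n n)

-- S^3_n : pairs (π², π³) of permutations of length n
S3 : (n : ℕ) → List (Vec (Fin n) n × Vec (Fin n) n)
S3 n = cartesianProduct (Perms n) (Perms n)

levels : {n : ℕ} → Vec (Fin n) n × Vec (Fin n) n → List ℕ
levels (p , q) = toList (zipWith (λ a b → toℕ a ⊔ toℕ b) p q)

WI : ℕ → ℕ
WI n = length (filter (λ Π → linked? _≤?_ (levels Π)) (S3 n))

Series : Set
Series = ℕ → ℚ

sumTo : ℕ → (ℕ → ℚ) → ℚ
sumTo zero    f = f 0
sumTo (suc n) f = sumTo n f ℚ.+ f (suc n)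

_⋆_ : Series → Series → Series
(f ⋆ g) n = sumTo n (λ k → f k ℚ.* g (n ∸ k))

_⊖_ : Series → Series → Series
(f ⊖ g) n = f n ℚ.- g n

oneS : Series
oneS zero    = 1ℚ
oneS (suc n) = 0ℚ

egf : (ℕ → ℕ) → Series
egf a n = _/_ (+ a n) (n !) {{n !≢0}}

-- n! · [x^n] cos x  and  n! · [x^n] sin x
cosNum : ℕ → ℤ
cosNum 0 = + 1
cosNum 1 = + 0
cosNum 2 = -[1+ 0 ]
cosNum 3 = + 0
cosNum (suc (suc (suc (suc n)))) = cosNum n

sinNum : ℕ → ℤ
sinNum 0 = + 0
sinNum 1 = + 1
sinNum 2 = + 0
sinNum 3 = -[1+ 0 ]
sinNum (suc (suc (suc (suc n)))) = sinNum n

cosS : Series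
cosS n = _/_ (cosNum n) (n !) {{n !≢0}}

sinS : Series
sinS n = _/_ (sinNum n) (n !) {{n !≢0}}

-- Read a 3-dimensional permutation column by column. When the levels weakly increase, the
-- columns of level t are consecutive, and as each of them contains an entry t there are at most
-- two: (t, t), or (t, b) and/or (a, t) with a, b < t. Scanning the levels upwards, both rows
-- always have the same number d of unused values below the current level, and counting the
-- choices level by level gives WI n = completions n 0, where
--   completions (f + 1) d = completions f (d + 1) + (1 + 2d) completions f d + 2d² completions f (d - 1).
-- For the EGFs F_d = Σₙ completions n d xⁿ/n! this says F_d′ = F_{d+1} + (1 + 2d) F_d + 2d² F_{d-1},
-- which is solved by F_d = d! (2 sin x)^d / (cos x - sin x)^{d+1}. Rather than solving it, we check
-- the consequence (1 + d) F_d ((cos + sin) - (cos - sin)) = F_{d+1} (cos - sin) coefficientwise,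
-- by induction on the degree simultaneously for all d; for d = 0 it says that the derivative of
-- F_0 (cos x - sin x) vanishes.

module Submission where

open import Defs
open import Data.Nat using (ℕ)
open import Relation.Binary.PropositionalEquality using (_≡_)

module Counting where

  open import Data.Bool using (if_then_else_)
  open import Data.Empty using (⊥-elim)
  open import Data.Fin using (Fin; toℕ; zero; suc)
  open import Data.Fin.Properties using (toℕ-injective; toℕ<n) renaming (_≟_ to _≟ᶠ_)
  open import Data.List using (List; []; _∷_; _++_; map; concatMap; allFin; filter; length; cartesianProduct)
  open import Data.List.Properties using (map-tabulate)
  open import Data.List.Relation.Unary.All as All using (All; []; _∷_)
  open import Data.List.Relation.Unary.AllPairs using (_∷_)
  open import Data.List.Relation.Unary.Any using (here; there)
  open import Data.List.Relation.Unary.Linked as Linked using (Linked; []; [-]; _∷_; linked?)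
  open import Data.Nat using (zero; suc; _+_; _*_; _∸_; _⊔_; _≤_; _<_; s≤s; z≤n; z<s; _≟_; _≤?_; _<?_)
  open import Data.Nat.Properties
    using (+-identityʳ; +-assoc; +-suc; *-zeroʳ; *-distribˡ-+; *-distribʳ-+; *-commutativeSemigroup;
           ⊔-comm; ⊔-lub; ≤-refl; ≤-reflexive; ≤-pred; n≮n; <-irrefl; ≤∧≢⇒<; <⇒≤; <⇒≱;
           <-≤-trans; m<n⇒m<1+n; m<m+n)
  open import Algebra.Properties.CommutativeSemigroup *-commutativeSemigroup using (x∙yz≈y∙xz)
  open import Data.Nat.Tactic.RingSolver using (solve-∀)
  open import Data.Product using (_×_; _,_; proj₁; proj₂; ∃-syntax)
  open import Data.Vec using (Vec; []; _∷_; toList; zipWith)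
  open import Function using (_∘_)
  open import Level using (0ℓ)
  open import Relation.Binary.PropositionalEquality
    using (_≢_; refl; sym; trans; cong; cong₂; subst; module ≡-Reasoning)
  open import Relation.Nullary using (Dec; does; yes; no; ¬_; _×-dec_)
  open import Relation.Unary using (Pred; Decidable)

  private
    variable
      A B : Set
      P Q : Set

  -- Defined through `does` alone, so that on comparisons of naturals it reduces by evaluation.
  𝟙[_] : Dec P → ℕ
  𝟙[ P? ] = if does P? then 1 else 0

  𝟙-yes : (P? : Dec P) → P → 𝟙[ P? ] ≡ 1
  𝟙-yes (yes _) _ = refl
  𝟙-yes (no ¬p) p = ⊥-elim (¬p p)

  𝟙-no : (P? : Dec P) → ¬ P → 𝟙[ P? ] ≡ 0
  𝟙-no (yes p) ¬p = ⊥-elim (¬p p)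
  𝟙-no (no _)  _  = refl

  𝟙-cong : (P? : Dec P) (Q? : Dec Q) → (P → Q) → (Q → P) → 𝟙[ P? ] ≡ 𝟙[ Q? ]
  𝟙-cong (yes p) Q? P→Q _   = sym (𝟙-yes Q? (P→Q p))
  𝟙-cong (no ¬p) Q? _   Q→P = sym (𝟙-no Q? (¬p ∘ Q→P))

  𝟙-⊎ : {R : Set} (R? : Dec R) (P? : Dec P) (Q? : Dec Q) →
        (R → ¬ P → Q) → (P → R) → (Q → R) → (P → ¬ Q) → 𝟙[ R? ] ≡ 𝟙[ P? ] + 𝟙[ Q? ]
  𝟙-⊎ R? (yes p) Q?     _      P→R _   P→¬Q =
    trans (𝟙-yes R? (P→R p)) (cong suc (sym (𝟙-no Q? (P→¬Q p))))
  𝟙-⊎ R? (no ¬p) (yes q) _     _   Q→R _    = 𝟙-yes R? (Q→R q)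
  𝟙-⊎ R? (no ¬p) (no ¬q) R→¬P→Q _ _  _    = 𝟙-no R? (λ r → ¬q (R→¬P→Q r ¬p))

  𝟙-× : (P? : Dec P) (Q? : Dec Q) → 𝟙[ P? ×-dec Q? ] ≡ 𝟙[ P? ] * 𝟙[ Q? ]
  𝟙-× (yes _) (yes _) = refl
  𝟙-× (yes _) (no _)  = refl
  𝟙-× (no _)  Q?      = refl

  𝟙-*-cong : (P? : Dec P) {m n : ℕ} → (P → m ≡ n) → 𝟙[ P? ] * m ≡ 𝟙[ P? ] * n
  𝟙-*-cong (yes p) m≡n = cong (_+ 0) (m≡n p)
  𝟙-*-cong (no _)  _   = refl

  ∑ : List A → (A → ℕ) → ℕ
  ∑ []       f = 0
  ∑ (x ∷ xs) f = f x + ∑ xs f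

  # : (xs : List A) {P : Pred A 0ℓ} → Decidable P → ℕ
  # xs P? = ∑ xs (λ x → 𝟙[ P? x ])

  ∑-cong : (xs : List A) {f g : A → ℕ} → (∀ x → f x ≡ g x) → ∑ xs f ≡ ∑ xs g
  ∑-cong []       f≗g = refl
  ∑-cong (x ∷ xs) f≗g = cong₂ _+_ (f≗g x) (∑-cong xs f≗g)

  ∑-zero : (xs : List A) {f : A → ℕ} → (∀ x → f x ≡ 0) → ∑ xs f ≡ 0
  ∑-zero []       f≗0 = refl
  ∑-zero (x ∷ xs) f≗0 = cong₂ _+_ (f≗0 x) (∑-zero xs f≗0)

  ∑-+ : (xs : List A) (f g : A → ℕ) → ∑ xs (λ x → f x + g x) ≡ ∑ xs f + ∑ xs g
  ∑-+ []       f g = refl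
  ∑-+ (x ∷ xs) f g = trans (cong (f x + g x +_) (∑-+ xs f g)) (+-interchange (f x) (g x) (∑ xs f) (∑ xs g))
    where
    +-interchange : ∀ a b c d → a + b + (c + d) ≡ a + c + (b + d)
    +-interchange = solve-∀

  ∑∑-+ : (xs : List A) (ys : List B) (f g : A → B → ℕ) →
         ∑ xs (λ x → ∑ ys (λ y → f x y + g x y))
         ≡ ∑ xs (λ x → ∑ ys (f x)) + ∑ xs (λ x → ∑ ys (g x))
  ∑∑-+ xs ys f g = trans (∑-cong xs (λ x → ∑-+ ys (f x) (g x))) (∑-+ xs _ _)

  ∑-*ˡ : (xs : List A) (c : ℕ) (f : A → ℕ) → ∑ xs (λ x → c * f x) ≡ c * ∑ xs f
  ∑-*ˡ []       c f = sym (*-zeroʳ c)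
  ∑-*ˡ (x ∷ xs) c f = trans (cong (c * f x +_) (∑-*ˡ xs c f)) (sym (*-distribˡ-+ c (f x) (∑ xs f)))

  ∑∑-*ˡ : (xs : List A) (ys : List B) (c : ℕ) (f : A → B → ℕ) →
          ∑ xs (λ x → ∑ ys (λ y → c * f x y)) ≡ c * ∑ xs (λ x → ∑ ys (f x))
  ∑∑-*ˡ xs ys c f = trans (∑-cong xs (λ x → ∑-*ˡ ys c (f x))) (∑-*ˡ xs c _)

  ∑-*ʳ : (xs : List A) (f : A → ℕ) (c : ℕ) → ∑ xs (λ x → f x * c) ≡ ∑ xs f * c
  ∑-*ʳ []       f c = refl
  ∑-*ʳ (x ∷ xs) f c = trans (cong (f x * c +_) (∑-*ʳ xs f c)) (sym (*-distribʳ-+ c (f x) (∑ xs f)))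

  ∑-++ : (xs ys : List A) (f : A → ℕ) → ∑ (xs ++ ys) f ≡ ∑ xs f + ∑ ys f
  ∑-++ []       ys f = refl
  ∑-++ (x ∷ xs) ys f = trans (cong (f x +_) (∑-++ xs ys f)) (sym (+-assoc (f x) (∑ xs f) (∑ ys f)))

  ∑-map : (g : A → B) (xs : List A) (f : B → ℕ) → ∑ (map g xs) f ≡ ∑ xs (f ∘ g)
  ∑-map g []       f = refl
  ∑-map g (x ∷ xs) f = cong (f (g x) +_) (∑-map g xs f)

  ∑-concatMap : (g : A → List B) (xs : List A) (f : B → ℕ) →
                ∑ (concatMap g xs) f ≡ ∑ xs (λ x → ∑ (g x) f)
  ∑-concatMap g []       f = refl
  ∑-concatMap g (x ∷ xs) f = trans (∑-++ (g x) (concatMap g xs) f) (cong (∑ (g x) f +_) (∑-concatMap g xs f))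

  ∑-cartesianProduct : (xs : List A) (ys : List B) (f : A × B → ℕ) →
                       ∑ (cartesianProduct xs ys) f ≡ ∑ xs (λ x → ∑ ys (λ y → f (x , y)))
  ∑-cartesianProduct []       ys f = refl
  ∑-cartesianProduct (x ∷ xs) ys f =
    trans (∑-++ (map (x ,_) ys) _ f) (cong₂ _+_ (∑-map (x ,_) ys f) (∑-cartesianProduct xs ys f))

  ∑-comm : (xs : List A) (ys : List B) (f : A → B → ℕ) →
           ∑ xs (λ x → ∑ ys (f x)) ≡ ∑ ys (λ y → ∑ xs (λ x → f x y))
  ∑-comm []       ys f = sym (∑-zero ys (λ _ → refl))
  ∑-comm (x ∷ xs) ys f = trans (cong (∑ ys (f x) +_) (∑-comm xs ys f)) (sym (∑-+ ys (f x) _))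

  ∑-allFin-suc : (k : ℕ) (f : Fin (suc k) → ℕ) →
                 ∑ (allFin (suc k)) f ≡ f zero + ∑ (allFin k) (f ∘ suc)
  ∑-allFin-suc k f =
    cong (f zero +_) (trans (cong (λ xs → ∑ xs f) (sym (map-tabulate (λ i → i) suc))) (∑-map suc (allFin k) f))

  ∑-words-suc : ∀ {k} L (f : Vec (Fin k) (suc L) → ℕ) →
                ∑ (words (suc L) k) f ≡ ∑ (allFin k) (λ a → ∑ (words L k) (λ p → f (a ∷ p)))
  ∑-words-suc {k} L f =
    trans (∑-concatMap _ (allFin k) f) (∑-cong (allFin k) (λ a → ∑-map (a ∷_) (words L k) f))

  length-filter≡# : (xs : List A) {P : Pred A 0ℓ} (P? : Decidable P) → length (filter P? xs) ≡ # xs P?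
  length-filter≡# []       P? = refl
  length-filter≡# (x ∷ xs) P? with P? x
  ... | yes _ = cong suc (length-filter≡# xs P?)
  ... | no  _ = length-filter≡# xs P?

  ∑-filter : (xs : List A) {P : Pred A 0ℓ} (P? : Decidable P) (f : A → ℕ) →
             ∑ (filter P? xs) f ≡ ∑ xs (λ x → 𝟙[ P? x ] * f x)
  ∑-filter []       P? f = refl
  ∑-filter (x ∷ xs) P? f with P? x
  ... | yes _ = cong₂ _+_ (sym (+-identityʳ (f x))) (∑-filter xs P? f)
  ... | no  _ = ∑-filter xs P? f

  ∑-𝟙-const : (xs : List A) {P : Pred A 0ℓ} (P? : Decidable P) {f : A → ℕ} {c : ℕ} →
              (∀ x → P x → f x ≡ c) → ∑ xs (λ x → 𝟙[ P? x ] * f x) ≡ # xs P? * c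
  ∑-𝟙-const xs P? {c = c} f≡c =
    trans (∑-cong xs (λ x → 𝟙-*-cong (P? x) (f≡c x))) (∑-*ʳ xs (λ x → 𝟙[ P? x ]) c)

  ∑-𝟙²-const : (xs : List A) (ys : List B) {P : Pred A 0ℓ} {Q : Pred B 0ℓ}
               (P? : Decidable P) (Q? : Decidable Q) {g : A → B → ℕ} {c : ℕ} →
               (∀ x y → P x → Q y → g x y ≡ c) →
               ∑ xs (λ x → ∑ ys (λ y → 𝟙[ P? x ] * (𝟙[ Q? y ] * g x y))) ≡ # xs P? * (# ys Q? * c)
  ∑-𝟙²-const xs ys P? Q? {g} g≡c =
    trans (∑-cong xs (λ x → ∑-*ˡ ys 𝟙[ P? x ] (λ y → 𝟙[ Q? y ] * g x y)))
          (∑-𝟙-const xs P? (λ x Px → ∑-𝟙-const ys Q? (λ y → g≡c x y Px)))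

  #toℕ≡-single : ∀ {k t} → t < k → # (allFin k) (λ a → toℕ a ≟ t) ≡ 1
  #toℕ≡-single {suc k} {zero}  _         =
    trans (∑-allFin-suc k (λ a → 𝟙[ toℕ a ≟ 0 ])) (cong suc (∑-zero (allFin k) (λ _ → refl)))
  #toℕ≡-single {suc k} {suc t} (s≤s t<k) =
    trans (∑-allFin-suc k (λ a → 𝟙[ toℕ a ≟ suc t ])) (#toℕ≡-single t<k)

  𝟙-≤-split : ∀ t m (g : ℕ → ℕ) →
              𝟙[ t ≤? m ] * g m ≡ 𝟙[ m ≟ t ] * g t + 𝟙[ suc t ≤? m ] * g m
  𝟙-≤-split t m g with m ≟ t
  ... | yes refl rewrite 𝟙-yes (t ≟ t) refl | 𝟙-yes (t ≤? t) ≤-refl | 𝟙-no (suc t ≤? t) (n≮n t) =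
    sym (+-identityʳ _)
  ... | no m≢t  rewrite 𝟙-no (m ≟ t) m≢t =
    cong (_* g m) (𝟙-cong (t ≤? m) (suc t ≤? m) (λ t≤m → ≤∧≢⇒< t≤m (m≢t ∘ sym)) <⇒≤)

  𝟙-⊔≟ : ∀ m n t →
         𝟙[ m ⊔ n ≟ t ] ≡ 𝟙[ m ≟ t ] * 𝟙[ n ≟ t ] + 𝟙[ m ≟ t ] * 𝟙[ n <? t ] + 𝟙[ m <? t ] * 𝟙[ n ≟ t ]
  𝟙-⊔≟ zero    zero    zero    = refl
  𝟙-⊔≟ zero    zero    (suc t) = refl
  𝟙-⊔≟ zero    (suc n) zero    = refl
  𝟙-⊔≟ zero    (suc n) (suc t) = sym (+-identityʳ _)
  𝟙-⊔≟ (suc m) zero    zero    = refl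
  𝟙-⊔≟ (suc m) zero    (suc t) = x≡x*0+x*1+y*0 𝟙[ m ≟ t ] 𝟙[ m <? t ]
    where
    x≡x*0+x*1+y*0 : ∀ x y → x ≡ x * 0 + x * 1 + y * 0
    x≡x*0+x*1+y*0 = solve-∀
  𝟙-⊔≟ (suc m) (suc n) zero    = refl
  𝟙-⊔≟ (suc m) (suc n) (suc t) = 𝟙-⊔≟ m n t

  0∷-linked : ∀ {xs} → Linked _≤_ xs → Linked _≤_ (0 ∷ xs)
  0∷-linked []      = [-]
  0∷-linked [-]     = z≤n ∷ [-]
  0∷-linked (r ∷ l) = z≤n ∷ r ∷ l

  -- Counting extensions level by level

  -- completions f d: the ways to fill the columns of the f highest levels when each row still has
  -- d unused values below them.
  completions : ℕ → ℕ → ℕ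
  completions zero    zero    = 1
  completions zero    (suc d) = 0
  completions (suc f) d =
    completions f (suc d) + (1 + 2 * d) * completions f d + 2 * d * d * completions f (d ∸ 1)

  module Extensions (k : ℕ) where

    open import Data.List.Membership.DecPropositional (_≟ᶠ_ {k}) using (_∈_; _∉_; _∉?_)
    open import Data.List.Relation.Unary.Unique.DecPropositional (_≟ᶠ_ {k}) using (Unique; unique?)

    lev : Fin k → Fin k → ℕ
    lev a b = toℕ a ⊔ toℕ b

    -- The ways to append L columns to two rows that have used the values Ap and Aq, keeping the
    -- levels weakly increasing and at least t.
    extensions : ℕ → List (Fin k) → List (Fin k) → ℕ → ℕ
    extensions zero    Ap Aq t = 1
    extensions (suc L) Ap Aq t = ∑ (allFin k) λ a → ∑ (allFin k) λ b →
      𝟙[ a ∉? Ap ] * (𝟙[ b ∉? Aq ] * (𝟙[ t ≤? lev a b ] * extensions L (a ∷ Ap) (b ∷ Aq) (lev a b)))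

    firstAtLevel : ℕ → List (Fin k) → List (Fin k) → ℕ → ℕ
    firstAtLevel L Ap Aq t = ∑ (allFin k) λ a → ∑ (allFin k) λ b →
      𝟙[ a ∉? Ap ] * (𝟙[ b ∉? Aq ] * (𝟙[ lev a b ≟ t ] * extensions L (a ∷ Ap) (b ∷ Aq) t))

    extensions-split : ∀ L Ap Aq t →
      extensions (suc L) Ap Aq t ≡ firstAtLevel L Ap Aq t + extensions (suc L) Ap Aq (suc t)
    extensions-split L Ap Aq t =
      trans (∑-cong (allFin k) (λ a → trans (∑-cong (allFin k) (λ b → column a b)) (∑-+ (allFin k) _ _)))
            (∑-+ (allFin k) _ _)
      where
      column : ∀ a b →
        𝟙[ a ∉? Ap ] * (𝟙[ b ∉? Aq ] * (𝟙[ t ≤? lev a b ] * extensions L (a ∷ Ap) (b ∷ Aq) (lev a b)))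
        ≡ 𝟙[ a ∉? Ap ] * (𝟙[ b ∉? Aq ] * (𝟙[ lev a b ≟ t ] * extensions L (a ∷ Ap) (b ∷ Aq) t))
          + 𝟙[ a ∉? Ap ] * (𝟙[ b ∉? Aq ]
                            * (𝟙[ suc t ≤? lev a b ] * extensions L (a ∷ Ap) (b ∷ Aq) (lev a b)))
      column a b = trans (cong (λ z → 𝟙[ a ∉? Ap ] * (𝟙[ b ∉? Aq ] * z))
                               (𝟙-≤-split t (lev a b) (extensions L (a ∷ Ap) (b ∷ Aq))))
                         (distrib 𝟙[ a ∉? Ap ] 𝟙[ b ∉? Aq ] _ _)
        where
        distrib : ∀ x y u v → x * (y * (u + v)) ≡ x * (y * u) + x * (y * v)
        distrib = solve-∀

    extensions-sym : ∀ L Ap Aq t → extensions L Ap Aq t ≡ extensions L Aq Ap t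
    extensions-sym zero    Ap Aq t = refl
    extensions-sym (suc L) Ap Aq t =
      trans (∑-cong (allFin k) (λ a → ∑-cong (allFin k) (λ b → swapped a b)))
            (∑-comm (allFin k) (allFin k) _)
      where
      swapped : ∀ a b →
        𝟙[ a ∉? Ap ] * (𝟙[ b ∉? Aq ] * (𝟙[ t ≤? lev a b ] * extensions L (a ∷ Ap) (b ∷ Aq) (lev a b)))
        ≡ 𝟙[ b ∉? Aq ] * (𝟙[ a ∉? Ap ] * (𝟙[ t ≤? lev b a ] * extensions L (b ∷ Aq) (a ∷ Ap) (lev b a)))
      swapped a b rewrite ⊔-comm (toℕ a) (toℕ b) | extensions-sym L (a ∷ Ap) (b ∷ Aq) (lev b a) =
        x∙yz≈y∙xz 𝟙[ a ∉? Ap ] 𝟙[ b ∉? Aq ]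
                  (𝟙[ t ≤? lev b a ] * extensions L (b ∷ Aq) (a ∷ Ap) (lev b a))

    extensions-beyond : ∀ L Ap Aq {t} → k ≤ t → extensions (suc L) Ap Aq t ≡ 0
    extensions-beyond L Ap Aq {t} k≤t =
      ∑-zero (allFin k) λ a → ∑-zero (allFin k) λ b →
        trans (cong (λ z → 𝟙[ a ∉? Ap ] * (𝟙[ b ∉? Aq ] * (z * extensions L (a ∷ Ap) (b ∷ Aq) (lev a b))))
                    (𝟙-no (t ≤? lev a b) (<⇒≱ (<-≤-trans (lev<k a b) k≤t))))
              (zero-product 𝟙[ a ∉? Ap ] 𝟙[ b ∉? Aq ])
      where
      lev<k : ∀ a b → lev a b < k
      lev<k a b = ⊔-lub (toℕ<n a) (toℕ<n b)
      zero-product : ∀ x y → x * (y * 0) ≡ 0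
      zero-product = solve-∀

    FreeAt FreeBelow : List (Fin k) → ℕ → Pred (Fin k) 0ℓ
    FreeAt    A t a = toℕ a ≡ t × a ∉ A
    FreeBelow A t a = toℕ a < t × a ∉ A

    freeAt? : (A : List (Fin k)) (t : ℕ) → Decidable (FreeAt A t)
    freeAt? A t a = toℕ a ≟ t ×-dec a ∉? A

    freeBelow? : (A : List (Fin k)) (t : ℕ) → Decidable (FreeBelow A t)
    freeBelow? A t a = toℕ a <? t ×-dec a ∉? A

    #freeAt #freeBelow : List (Fin k) → ℕ → ℕ
    #freeAt    A t = # (allFin k) (freeAt? A t)
    #freeBelow A t = # (allFin k) (freeBelow? A t)

    ∉-∷⁺ : ∀ {y x A} → y ≢ x → y ∉ A → y ∉ x ∷ A
    ∉-∷⁺ y≢x _   (here y≡x)  = y≢x y≡x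
    ∉-∷⁺ _   y∉A (there y∈A) = y∉A y∈A

    ¬freeAt-used : ∀ {A t x a} → x ∈ A → toℕ x ≡ t → ¬ FreeAt A t a
    ¬freeAt-used {A} x∈A x≡t (a≡t , a∉A) = a∉A (subst (_∈ A) (toℕ-injective (trans x≡t (sym a≡t))) x∈A)

    module _ {A : List (Fin k)} {t : ℕ} where

      #freeAt-fresh : All (λ x → toℕ x < t) A → t < k → #freeAt A t ≡ 1
      #freeAt-fresh A<t t<k =
        trans (∑-cong (allFin k) (λ a → 𝟙-cong (freeAt? A t a) (toℕ a ≟ t) proj₁
                                          (λ a≡t → a≡t , λ a∈A → <-irrefl a≡t (All.lookup A<t a∈A))))
              (#toℕ≡-single t<k)

      #freeAt-used : ∀ {x} → x ∈ A → toℕ x ≡ t → #freeAt A t ≡ 0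
      #freeAt-used x∈A x≡t = ∑-zero (allFin k) λ a → 𝟙-no (freeAt? A t a) (¬freeAt-used x∈A x≡t)

      #freeBelow-suc : All (λ x → toℕ x < t) A → t < k → #freeBelow A (suc t) ≡ suc (#freeBelow A t)
      #freeBelow-suc A<t t<k =
        trans (∑-cong (allFin k) (λ a → 𝟙-⊎ (freeBelow? A (suc t) a) (toℕ a ≟ t) (freeBelow? A t a)
                  (λ (a<1+t , a∉A) a≢t → ≤∧≢⇒< (≤-pred a<1+t) a≢t , a∉A)
                  (λ a≡t → s≤s (≤-reflexive a≡t) , λ a∈A → <-irrefl a≡t (All.lookup A<t a∈A))
                  (λ (a<t , a∉A) → m<n⇒m<1+n a<t , a∉A)
                  (λ a≡t (a<t , _) → <-irrefl a≡t a<t)))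
              (trans (∑-+ (allFin k) _ _) (cong (_+ #freeBelow A t) (#toℕ≡-single t<k)))

      #freeBelow-∷-at : ∀ {a} → toℕ a ≡ t → #freeBelow (a ∷ A) (suc t) ≡ #freeBelow A t
      #freeBelow-∷-at {a} a≡t =
        ∑-cong (allFin k) λ y → 𝟙-cong (freeBelow? (a ∷ A) (suc t) y) (freeBelow? A t y)
          (λ (y<1+t , y∉a∷A) →
             ≤∧≢⇒< (≤-pred y<1+t) (λ y≡t → y∉a∷A (here (toℕ-injective (trans y≡t (sym a≡t))))) , y∉a∷A ∘ there)
          (λ (y<t , y∉A) →
             m<n⇒m<1+n y<t , ∉-∷⁺ (λ y≡a → <-irrefl (trans (cong toℕ y≡a) a≡t) y<t) y∉A)

      #freeBelow-∷-above : ∀ {a} → t ≤ toℕ a → #freeBelow (a ∷ A) t ≡ #freeBelow A t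
      #freeBelow-∷-above {a} t≤a =
        ∑-cong (allFin k) λ y → 𝟙-cong (freeBelow? (a ∷ A) t y) (freeBelow? A t y)
          (λ (y<t , y∉a∷A) → y<t , y∉a∷A ∘ there)
          (λ (y<t , y∉A) → y<t , ∉-∷⁺ (λ y≡a → <-irrefl (cong toℕ y≡a) (<-≤-trans y<t t≤a)) y∉A)

      #freeBelow-∷-below : ∀ {x} → FreeBelow A t x → suc (#freeBelow (x ∷ A) t) ≡ #freeBelow A t
      #freeBelow-∷-below {x} (x<t , x∉A) = sym
        (trans (∑-cong (allFin k) (λ y → 𝟙-⊎ (freeBelow? A t y) (toℕ y ≟ toℕ x) (freeBelow? (x ∷ A) t y)
                  (λ (y<t , y∉A) y≢x → y<t , ∉-∷⁺ (y≢x ∘ cong toℕ) y∉A)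
                  (λ y≡x → subst (FreeBelow A t) (sym (toℕ-injective y≡x)) (x<t , x∉A))
                  (λ (y<t , y∉x∷A) → y<t , y∉x∷A ∘ there)
                  (λ y≡x (_ , y∉x∷A) → y∉x∷A (here (toℕ-injective y≡x)))))
               (trans (∑-+ (allFin k) _ _) (cong (_+ #freeBelow (x ∷ A) t) (#toℕ≡-single (toℕ<n x)))))

    -- A column of level t has t in one row and either t or a value below t in the other.
    firstAtLevel-regions : ∀ L Ap Aq t {c₁ c₂ c₃} →
      (∀ a b → FreeAt Ap t a → FreeAt Aq t b → extensions L (a ∷ Ap) (b ∷ Aq) t ≡ c₁) →
      (∀ a b → FreeAt Ap t a → FreeBelow Aq t b → extensions L (a ∷ Ap) (b ∷ Aq) t ≡ c₂) →
      (∀ a b → FreeBelow Ap t a → FreeAt Aq t b → extensions L (a ∷ Ap) (b ∷ Aq) t ≡ c₃) →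
      firstAtLevel L Ap Aq t ≡ #freeAt Ap t * (#freeAt Aq t * c₁) + #freeAt Ap t * (#freeBelow Aq t * c₂)
                               + #freeBelow Ap t * (#freeAt Aq t * c₃)
    firstAtLevel-regions L Ap Aq t h₁ h₂ h₃ =
      trans (∑-cong (allFin k) (λ a → ∑-cong (allFin k) (column a)))
      (trans (∑∑-+ (allFin k) (allFin k) (λ a b → R₁ a b + R₂ a b) R₃)
      (cong₂ _+_ (trans (∑∑-+ (allFin k) (allFin k) R₁ R₂)
                        (cong₂ _+_ (∑-𝟙²-const (allFin k) (allFin k) (freeAt? Ap t) (freeAt? Aq t) h₁)
                                   (∑-𝟙²-const (allFin k) (allFin k) (freeAt? Ap t) (freeBelow? Aq t) h₂)))
                 (∑-𝟙²-const (allFin k) (allFin k) (freeBelow? Ap t) (freeAt? Aq t) h₃)))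
      where
      g : Fin k → Fin k → ℕ
      g a b = extensions L (a ∷ Ap) (b ∷ Aq) t
      R₁ R₂ R₃ : Fin k → Fin k → ℕ
      R₁ a b = 𝟙[ freeAt? Ap t a ] * (𝟙[ freeAt? Aq t b ] * g a b)
      R₂ a b = 𝟙[ freeAt? Ap t a ] * (𝟙[ freeBelow? Aq t b ] * g a b)
      R₃ a b = 𝟙[ freeBelow? Ap t a ] * (𝟙[ freeAt? Aq t b ] * g a b)
      regroup : ∀ x y ea eb la lb z → x * (y * ((ea * eb + ea * lb + la * eb) * z))
                                    ≡ ea * x * (eb * y * z) + ea * x * (lb * y * z) + la * x * (eb * y * z)
      regroup = solve-∀
      column : ∀ a b → 𝟙[ a ∉? Ap ] * (𝟙[ b ∉? Aq ] * (𝟙[ lev a b ≟ t ] * g a b))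
                       ≡ R₁ a b + R₂ a b + R₃ a b
      column a b
        rewrite 𝟙-⊔≟ (toℕ a) (toℕ b) t
              | 𝟙-× (toℕ a ≟ t) (a ∉? Ap) | 𝟙-× (toℕ b ≟ t) (b ∉? Aq)
              | 𝟙-× (toℕ a <? t) (a ∉? Ap) | 𝟙-× (toℕ b <? t) (b ∉? Aq)
        = regroup 𝟙[ a ∉? Ap ] 𝟙[ b ∉? Aq ] 𝟙[ toℕ a ≟ t ] 𝟙[ toℕ b ≟ t ]
                  𝟙[ toℕ a <? t ] 𝟙[ toℕ b <? t ] (g a b)

    extensions-skip-used-level : ∀ L {Ap Aq t x y} → x ∈ Ap → toℕ x ≡ t → y ∈ Aq → toℕ y ≡ t →
                                 extensions L Ap Aq t ≡ extensions L Ap Aq (suc t)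
    extensions-skip-used-level zero    _ _ _ _ = refl
    extensions-skip-used-level (suc L) {Ap} {Aq} {t} x∈Ap x≡t y∈Aq y≡t =
      trans (extensions-split L Ap Aq t) (cong (_+ extensions (suc L) Ap Aq (suc t)) no-first-column)
      where
      no-first-column : firstAtLevel L Ap Aq t ≡ 0
      no-first-column =
        trans (firstAtLevel-regions L Ap Aq t {0} {0} {0}
                 (λ _ _ a-free _ → ⊥-elim (¬freeAt-used x∈Ap x≡t a-free))
                 (λ _ _ a-free _ → ⊥-elim (¬freeAt-used x∈Ap x≡t a-free))
                 (λ _ _ _ b-free → ⊥-elim (¬freeAt-used y∈Aq y≡t b-free)))
              (evaluate (#freeAt-used x∈Ap x≡t) (#freeAt-used y∈Aq y≡t))
        where
        evaluate : ∀ {x y} → x ≡ 0 → y ≡ 0 →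
                   x * (y * 0) + x * (#freeBelow Aq t * 0) + #freeBelow Ap t * (y * 0) ≡ 0
        evaluate refl refl = *-zeroʳ (#freeBelow Ap t)

    record Pending (t d : ℕ) (A : List (Fin k)) : Set where
      constructor pending
      field
        bounded : All (λ x → toℕ x < t) A
        unused  : #freeBelow A t ≡ d

    open Pending

    pending-suc-free : ∀ {t d A} → Pending t d A → t < k → Pending (suc t) (suc d) A
    pending-suc-free (pending A<t #≡d) t<k =
      pending (All.map m<n⇒m<1+n A<t) (trans (#freeBelow-suc A<t t<k) (cong suc #≡d))

    pending-suc-used : ∀ {t d A a} → Pending t d A → toℕ a ≡ t → Pending (suc t) d (a ∷ A)
    pending-suc-used {A = A} (pending A<t #≡d) a≡t =
      pending (s≤s (≤-reflexive a≡t) ∷ All.map m<n⇒m<1+n A<t) (trans (#freeBelow-∷-at {A = A} a≡t) #≡d)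

    pending-∷-below : ∀ {t d A x} → Pending t d A → FreeBelow A t x →
                      ∃[ d′ ] d ≡ suc d′ × Pending t d′ (x ∷ A)
    pending-∷-below {A = A} (pending A<t #≡d) x-free@(x<t , _) =
      _ , trans (sym #≡d) (sym (#freeBelow-∷-below {A = A} x-free)) , pending (x<t ∷ A<t) refl

    -- Each row must still place its d unused values below t and the f values from t on, so exactly
    -- d + f columns remain.
    ExtensionsFormula : ℕ → Set
    ExtensionsFormula f = ∀ {t d Ap Aq} → t + f ≡ k → Pending t d Ap → Pending t d Aq →
                          extensions (d + f) Ap Aq t ≡ completions f d

    extensions-formula-zero : ExtensionsFormula 0
    extensions-formula-zero {d = zero}  _      _ _ = refl
    extensions-formula-zero {t} {suc d} {Ap} {Aq} t+0≡k _ _ =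
      extensions-beyond (d + 0) Ap Aq (≤-reflexive (trans (sym t+0≡k) (+-identityʳ t)))

    module Step {f} (ih : ExtensionsFormula f) {t} (t+1+f≡k : t + suc f ≡ k) where

      t<k : t < k
      t<k = subst (t <_) t+1+f≡k (m<m+n t z<s)

      suc-t+f≡k : suc t + f ≡ k
      suc-t+f≡k = trans (sym (+-suc t f)) t+1+f≡k

      after-both-at-level : ∀ {d Ap Aq a b} → Pending t d Ap → Pending t d Aq → toℕ a ≡ t → toℕ b ≡ t →
                            extensions (d + f) (a ∷ Ap) (b ∷ Aq) t ≡ completions f d
      after-both-at-level {d} pp pq a≡t b≡t =
        trans (extensions-skip-used-level (d + f) (here refl) a≡t (here refl) b≡t)
              (ih suc-t+f≡k (pending-suc-used pp a≡t) (pending-suc-used pq b≡t))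

      -- After a column (t, b) with b < t, the only further column of level t has the form (a′, t).
      after-first-at-level : ∀ {d Ap Aq a b} →
        Pending t d Ap → Pending t d Aq → toℕ a ≡ t → FreeBelow Aq t b →
        extensions (d + f) (a ∷ Ap) (b ∷ Aq) t ≡ d * completions f (d ∸ 1) + completions f d
      after-first-at-level {Ap = Ap} {Aq} {a} {b} pp pq a≡t b-free with pending-∷-below pq b-free
      ... | d′ , refl , pq′ =
        trans (extensions-split (d′ + f) (a ∷ Ap) (b ∷ Aq) t)
              (trans (cong₂ _+_ (firstAtLevel-regions (d′ + f) (a ∷ Ap) (b ∷ Aq) t {0} {0}
                                   (λ _ _ a′-free _ → ⊥-elim (¬freeAt-used (here refl) a≡t a′-free))
                                   (λ _ _ a′-free _ → ⊥-elim (¬freeAt-used (here refl) a≡t a′-free))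
                                   second-column)
                                (ih suc-t+f≡k (pending-suc-used pp a≡t) (pending-suc-free pq′ t<k)))
                     (evaluate (#freeAt-used {A = a ∷ Ap} (here refl) a≡t) (#freeAt-fresh (bounded pq′) t<k)
                               (trans (#freeBelow-∷-above {A = Ap} (≤-reflexive (sym a≡t))) (unused pp))))
        where
        second-column : ∀ a′ b′ → FreeBelow (a ∷ Ap) t a′ → FreeAt (b ∷ Aq) t b′ →
                        extensions (d′ + f) (a′ ∷ a ∷ Ap) (b′ ∷ b ∷ Aq) t ≡ completions f d′
        second-column a′ b′ (a′<t , a′∉a∷Ap) (b′≡t , _)
          with pending-∷-below (pending-suc-used pp a≡t) (m<n⇒m<1+n a′<t , a′∉a∷Ap)
        ... | _ , refl , pp′ =
          trans (extensions-skip-used-level (d′ + f) (there (here refl)) a≡t (here refl) b′≡t)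
                (ih suc-t+f≡k pp′ (pending-suc-used pq′ b′≡t))
        evaluate : ∀ {x y z} → x ≡ 0 → y ≡ 1 → z ≡ suc d′ →
                   x * (y * 0) + x * (#freeBelow (b ∷ Aq) t * 0) + z * (y * completions f d′) + completions f (suc d′)
                   ≡ suc d′ * completions f d′ + completions f (suc d′)
        evaluate refl refl refl = cong (λ c → suc d′ * c + completions f (suc d′)) (+-identityʳ (completions f d′))

      after-second-at-level : ∀ {d Ap Aq a b} →
        Pending t d Ap → Pending t d Aq → FreeBelow Ap t a → toℕ b ≡ t →
        extensions (d + f) (a ∷ Ap) (b ∷ Aq) t ≡ d * completions f (d ∸ 1) + completions f d
      after-second-at-level {d} {Ap} {Aq} {a} {b} pp pq a-free b≡t =
        trans (extensions-sym (d + f) (a ∷ Ap) (b ∷ Aq) t) (after-first-at-level pq pp b≡t a-free)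

    extensions-formula-suc : ∀ {f} → ExtensionsFormula f → ExtensionsFormula (suc f)
    extensions-formula-suc {f} ih {t} {d} {Ap} {Aq} t+1+f≡k pp pq = begin
      extensions (d + suc f) Ap Aq t
        ≡⟨ cong (λ L → extensions L Ap Aq t) (+-suc d f) ⟩
      extensions (suc (d + f)) Ap Aq t
        ≡⟨ extensions-split (d + f) Ap Aq t ⟩
      firstAtLevel (d + f) Ap Aq t + extensions (suc d + f) Ap Aq (suc t)
        ≡⟨ cong₂ _+_ (firstAtLevel-regions (d + f) Ap Aq t
                        (λ _ _ (a≡t , _) (b≡t , _) → after-both-at-level pp pq a≡t b≡t)
                        (λ _ _ (a≡t , _) b-free → after-first-at-level pp pq a≡t b-free)
                        (λ _ _ a-free (b≡t , _) → after-second-at-level pp pq a-free b≡t))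
                     (ih suc-t+f≡k (pending-suc-free pp t<k) (pending-suc-free pq t<k)) ⟩
      #freeAt Ap t * (#freeAt Aq t * M f d) + #freeAt Ap t * (#freeBelow Aq t * H)
        + #freeBelow Ap t * (#freeAt Aq t * H) + M f (suc d)
        ≡⟨ counted ⟩
      completions (suc f) d ∎
      where
      open Step ih t+1+f≡k
      open ≡-Reasoning
      M : ℕ → ℕ → ℕ
      M = completions
      H : ℕ
      H = d * M f (d ∸ 1) + M f d
      arithmetic : ∀ d x y z → 1 * (1 * x) + 1 * (d * (d * y + x)) + d * (1 * (d * y + x)) + z
                             ≡ z + (1 + 2 * d) * x + 2 * d * d * y
      arithmetic = solve-∀
      counted : #freeAt Ap t * (#freeAt Aq t * M f d) + #freeAt Ap t * (#freeBelow Aq t * H)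
                + #freeBelow Ap t * (#freeAt Aq t * H) + M f (suc d) ≡ completions (suc f) d
      counted = evaluate (#freeAt-fresh (bounded pp) t<k) (#freeAt-fresh (bounded pq) t<k)
                         (unused pp) (unused pq)
        where
        evaluate : ∀ {x y z w} → x ≡ 1 → y ≡ 1 → z ≡ d → w ≡ d →
                   x * (y * M f d) + x * (w * H) + z * (y * H) + M f (suc d) ≡ completions (suc f) d
        evaluate refl refl refl refl = arithmetic d (M f d) (M f (d ∸ 1)) (M f (suc d))

    extensions-formula : ∀ f → ExtensionsFormula f
    extensions-formula zero    = extensions-formula-zero
    extensions-formula (suc f) = extensions-formula-suc (extensions-formula f)

    extensions-from-empty : extensions k [] [] 0 ≡ completions k 0
    extensions-from-empty = extensions-formula k refl empty empty
      where
      empty : Pending 0 0 []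
      empty = pending [] (∑-zero (allFin k) (λ _ → refl))

    Fresh : List (Fin k) → List (Fin k) → Set
    Fresh A xs = All (_∉ A) xs × Unique xs

    fresh? : (A xs : List (Fin k)) → Dec (Fresh A xs)
    fresh? A xs = All.all? (_∉? A) xs ×-dec unique? xs

    fresh-∷⁻ : ∀ {A x xs} → Fresh A (x ∷ xs) → x ∉ A × Fresh (x ∷ A) xs
    fresh-∷⁻ (x∉A ∷ xs∉A , x≢xs ∷ xs-unique) =
      x∉A , All.map (λ (x≢y , y∉A) → ∉-∷⁺ (x≢y ∘ sym) y∉A) (All.zip (x≢xs , xs∉A))
          , xs-unique

    fresh-∷⁺ : ∀ {A x xs} → x ∉ A → Fresh (x ∷ A) xs → Fresh A (x ∷ xs)
    fresh-∷⁺ x∉A (xs∉x∷A , xs-unique) =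
      (x∉A ∷ All.map (_∘ there) xs∉x∷A)
      , (All.map (λ y∉x∷A x≡y → y∉x∷A (here (sym x≡y))) xs∉x∷A ∷ xs-unique)

    levelsOf : ∀ {L} → Vec (Fin k) L → Vec (Fin k) L → List ℕ
    levelsOf p q = toList (zipWith lev p q)

    Admissible : ∀ {L} → List (Fin k) → List (Fin k) → ℕ → Vec (Fin k) L → Vec (Fin k) L → Set
    Admissible Ap Aq t p q = Fresh Ap (toList p) × Fresh Aq (toList q) × Linked _≤_ (t ∷ levelsOf p q)

    admissible? : ∀ {L} Ap Aq t (p q : Vec (Fin k) L) → Dec (Admissible Ap Aq t p q)
    admissible? Ap Aq t p q =
      fresh? Ap (toList p) ×-dec fresh? Aq (toList q) ×-dec linked? _≤?_ (t ∷ levelsOf p q)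

    𝟙-admissible-∷ : ∀ {L} Ap Aq t a b (p q : Vec (Fin k) L) →
      𝟙[ admissible? Ap Aq t (a ∷ p) (b ∷ q) ]
      ≡ 𝟙[ a ∉? Ap ] * (𝟙[ b ∉? Aq ] * (𝟙[ t ≤? lev a b ] * 𝟙[ admissible? (a ∷ Ap) (b ∷ Aq) (lev a b) p q ]))
    𝟙-admissible-∷ Ap Aq t a b p q =
      trans (𝟙-cong (admissible? Ap Aq t (a ∷ p) (b ∷ q))
                    (a ∉? Ap ×-dec b ∉? Aq ×-dec t ≤? lev a b ×-dec rest?) split join)
            (trans (𝟙-× (a ∉? Ap) (b ∉? Aq ×-dec t ≤? lev a b ×-dec rest?))
            (cong (𝟙[ a ∉? Ap ] *_) (trans (𝟙-× (b ∉? Aq) (t ≤? lev a b ×-dec rest?))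
            (cong (𝟙[ b ∉? Aq ] *_) (𝟙-× (t ≤? lev a b) rest?)))))
      where
      Rest : Set
      Rest = Admissible (a ∷ Ap) (b ∷ Aq) (lev a b) p q
      rest? : Dec Rest
      rest? = admissible? (a ∷ Ap) (b ∷ Aq) (lev a b) p q
      split : Admissible Ap Aq t (a ∷ p) (b ∷ q) → a ∉ Ap × b ∉ Aq × t ≤ lev a b × Rest
      split (a∷p-fresh , b∷q-fresh , t≤lev ∷ rest) =
        let a∉Ap , p-fresh = fresh-∷⁻ a∷p-fresh ; b∉Aq , q-fresh = fresh-∷⁻ b∷q-fresh
        in a∉Ap , b∉Aq , t≤lev , p-fresh , q-fresh , rest
      join : a ∉ Ap × b ∉ Aq × t ≤ lev a b × Rest → Admissible Ap Aq t (a ∷ p) (b ∷ q)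
      join (a∉Ap , b∉Aq , t≤lev , p-fresh , q-fresh , rest) =
        fresh-∷⁺ a∉Ap p-fresh , fresh-∷⁺ b∉Aq q-fresh , t≤lev ∷ rest

    extensions-words : ∀ L Ap Aq t →
      extensions L Ap Aq t ≡ ∑ (words L k) λ p → ∑ (words L k) λ q → 𝟙[ admissible? Ap Aq t p q ]
    extensions-words zero    Ap Aq t = refl
    extensions-words (suc L) Ap Aq t = sym (begin
      ∑ (words (suc L) k) (λ p → ∑ (words (suc L) k) (λ q → 𝟙[ admissible? Ap Aq t p q ]))
        ≡⟨ ∑-words-suc L (λ p → ∑ (words (suc L) k) (λ q → 𝟙[ admissible? Ap Aq t p q ])) ⟩
      ∑ (allFin k) (λ a → ∑ (words L k) (λ p → ∑ (words (suc L) k) (λ q →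
        𝟙[ admissible? Ap Aq t (a ∷ p) q ])))
        ≡⟨ ∑-cong (allFin k) (λ a → ∑-cong (words L k) (λ p →
             ∑-words-suc L (λ q → 𝟙[ admissible? Ap Aq t (a ∷ p) q ]))) ⟩
      ∑ (allFin k) (λ a → ∑ (words L k) (λ p → ∑ (allFin k) (λ b → ∑ (words L k) (λ q →
        𝟙[ admissible? Ap Aq t (a ∷ p) (b ∷ q) ]))))
        ≡⟨ ∑-cong (allFin k) (λ a → ∑-comm (words L k) (allFin k) _) ⟩
      ∑ (allFin k) (λ a → ∑ (allFin k) (λ b → ∑ (words L k) (λ p → ∑ (words L k) (λ q →
        𝟙[ admissible? Ap Aq t (a ∷ p) (b ∷ q) ]))))
        ≡⟨ ∑-cong (allFin k) (λ a → ∑-cong (allFin k) (λ b → first-column a b)) ⟩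
      extensions (suc L) Ap Aq t ∎)
      where
      open ≡-Reasoning
      first-column : ∀ a b →
        ∑ (words L k) (λ p → ∑ (words L k) (λ q → 𝟙[ admissible? Ap Aq t (a ∷ p) (b ∷ q) ]))
        ≡ 𝟙[ a ∉? Ap ] * (𝟙[ b ∉? Aq ] * (𝟙[ t ≤? lev a b ] * extensions L (a ∷ Ap) (b ∷ Aq) (lev a b)))
      first-column a b = begin
        _ ≡⟨ ∑-cong (words L k) (λ p → ∑-cong (words L k) (λ q → 𝟙-admissible-∷ Ap Aq t a b p q)) ⟩
        _ ≡⟨ ∑∑-*ˡ (words L k) (words L k) 𝟙[ a ∉? Ap ] _ ⟩
        _ ≡⟨ cong (𝟙[ a ∉? Ap ] *_) (∑∑-*ˡ (words L k) (words L k) 𝟙[ b ∉? Aq ] _) ⟩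
        _ ≡⟨ cong (λ z → 𝟙[ a ∉? Ap ] * (𝟙[ b ∉? Aq ] * z))
                  (∑∑-*ˡ (words L k) (words L k) 𝟙[ t ≤? lev a b ] _) ⟩
        _ ≡⟨ cong (λ z → 𝟙[ a ∉? Ap ] * (𝟙[ b ∉? Aq ] * (𝟙[ t ≤? lev a b ] * z)))
                  (sym (extensions-words L (a ∷ Ap) (b ∷ Aq) (lev a b))) ⟩
        _ ∎

  WI≡completions : ∀ n → WI n ≡ completions n 0
  WI≡completions n = begin
    length (filter L? (cartesianProduct (Perms n) (Perms n)))
      ≡⟨ length-filter≡# (cartesianProduct (Perms n) (Perms n)) L? ⟩
    ∑ (cartesianProduct (Perms n) (Perms n)) (λ Π → 𝟙[ L? Π ])
      ≡⟨ ∑-cartesianProduct (Perms n) (Perms n) _ ⟩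
    ∑ (Perms n) (λ p → ∑ (Perms n) (λ q → 𝟙[ L? (p , q) ]))
      ≡⟨ ∑-filter (words n n) U? _ ⟩
    ∑ (words n n) (λ p → 𝟙[ U? p ] * ∑ (Perms n) (λ q → 𝟙[ L? (p , q) ]))
      ≡⟨ ∑-cong (words n n) (λ p → cong (𝟙[ U? p ] *_) (∑-filter (words n n) U? _)) ⟩
    ∑ (words n n) (λ p → 𝟙[ U? p ] * ∑ (words n n) (λ q → 𝟙[ U? q ] * 𝟙[ L? (p , q) ]))
      ≡⟨ ∑-cong (words n n) (λ p → sym (∑-*ˡ (words n n) 𝟙[ U? p ] _)) ⟩
    ∑ (words n n) (λ p → ∑ (words n n) (λ q → 𝟙[ U? p ] * (𝟙[ U? q ] * 𝟙[ L? (p , q) ])))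
      ≡⟨ ∑-cong (words n n) (λ p → ∑-cong (words n n) (λ q → admissible-from-scratch p q)) ⟩
    ∑ (words n n) (λ p → ∑ (words n n) (λ q → 𝟙[ admissible? [] [] 0 p q ]))
      ≡⟨ sym (extensions-words n [] [] 0) ⟩
    extensions n [] [] 0
      ≡⟨ extensions-from-empty ⟩
    completions n 0 ∎
    where
    open ≡-Reasoning
    open Extensions n
    open import Data.List.Relation.Unary.Unique.DecPropositional (_≟ᶠ_ {n}) using (Unique; unique?)
    U? : (v : Vec (Fin n) n) → Dec (Unique (toList v))
    U? v = unique? (toList v)
    L? : (Π : Vec (Fin n) n × Vec (Fin n) n) → Dec (Linked _≤_ (levels Π))
    L? Π = linked? _≤?_ (levels Π)
    𝟙-fresh[] : ∀ (v : Vec (Fin n) n) → 𝟙[ fresh? [] (toList v) ] ≡ 𝟙[ U? v ]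
    𝟙-fresh[] v = 𝟙-cong (fresh? [] (toList v)) (U? v) proj₂ (λ u → All.universal (λ _ ()) _ , u)
    admissible-from-scratch : ∀ p q →
      𝟙[ U? p ] * (𝟙[ U? q ] * 𝟙[ L? (p , q) ]) ≡ 𝟙[ admissible? [] [] 0 p q ]
    admissible-from-scratch p q = sym (trans (𝟙-× (fresh? [] (toList p)) (fresh? [] (toList q) ×-dec linked?₀))
      (cong₂ _*_ (𝟙-fresh[] p) (trans (𝟙-× (fresh? [] (toList q)) linked?₀) (cong₂ _*_ (𝟙-fresh[] q)
        (𝟙-cong linked?₀ (L? (p , q)) Linked.tail 0∷-linked)))))
      where
      linked?₀ : Dec (Linked _≤_ (0 ∷ levelsOf p q))
      linked?₀ = linked? _≤?_ (0 ∷ levelsOf p q)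

open Counting using (completions; WI≡completions)

module Convolution where

  open import Data.Integer using (ℤ; +_; _+_; _*_; -_; _-_; 0ℤ)
  open import Data.Integer.Properties using (pos-+; pos-*; *-distribʳ-+; *-distribˡ-+; *-zeroʳ; +-identityʳ; -1*i≡-i)
  open import Data.Integer.Tactic.RingSolver using (solve-∀)
  open import Data.Nat as ℕ using (zero; suc; _∸_; _≤_; z≤n)
  open import Data.Nat.Combinatorics using (_C_; k>n⇒nCk≡0; nCk+nC[k+1]≡[n+1]C[k+1])
  open import Data.Nat.Properties using (m≤n⇒m≤1+n; ≤-refl; +-∸-assoc; n<1+n)
  open import Function using (_∘_)
  open import Relation.Binary.PropositionalEquality using (refl; sym; trans; cong; cong₂; module ≡-Reasoning)

  sumToℤ : ℕ → (ℕ → ℤ) → ℤ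
  sumToℤ zero    f = f 0
  sumToℤ (suc n) f = sumToℤ n f + f (suc n)

  sumToℤ-cong : ∀ n {f g : ℕ → ℤ} → (∀ k → k ≤ n → f k ≡ g k) → sumToℤ n f ≡ sumToℤ n g
  sumToℤ-cong zero    f≗g = f≗g 0 z≤n
  sumToℤ-cong (suc n) f≗g =
    cong₂ _+_ (sumToℤ-cong n (λ k k≤n → f≗g k (m≤n⇒m≤1+n k≤n))) (f≗g (suc n) ≤-refl)

  sumToℤ-+ : ∀ n (f g : ℕ → ℤ) → sumToℤ n (λ k → f k + g k) ≡ sumToℤ n f + sumToℤ n g
  sumToℤ-+ zero    f g = refl
  sumToℤ-+ (suc n) f g = trans (cong (_+ (f (suc n) + g (suc n))) (sumToℤ-+ n f g))
                               (interchange (sumToℤ n f) (sumToℤ n g) (f (suc n)) (g (suc n)))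
    where
    interchange : ∀ a b c d → a + b + (c + d) ≡ a + c + (b + d)
    interchange = solve-∀

  sumToℤ-*ˡ : ∀ n c (f : ℕ → ℤ) → sumToℤ n (λ k → c * f k) ≡ c * sumToℤ n f
  sumToℤ-*ˡ zero    c f = refl
  sumToℤ-*ˡ (suc n) c f =
    trans (cong (_+ c * f (suc n)) (sumToℤ-*ˡ n c f)) (sym (*-distribˡ-+ c (sumToℤ n f) (f (suc n))))

  sumToℤ-suc : ∀ n (f : ℕ → ℤ) → sumToℤ (suc n) f ≡ f 0 + sumToℤ n (f ∘ suc)
  sumToℤ-suc zero    f = refl
  sumToℤ-suc (suc n) f =
    trans (cong (_+ f (suc (suc n))) (sumToℤ-suc n f)) (assoc (f 0) (sumToℤ n (f ∘ suc)) (f (suc (suc n))))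
    where
    assoc : ∀ a b c → a + b + c ≡ a + (b + c)
    assoc = solve-∀

  -- (A ⊛ B) n is n! [xⁿ] of the product of the exponential generating functions of A and B.
  infixl 7 _⊛_

  _⊛_ : (ℕ → ℤ) → (ℕ → ℤ) → ℕ → ℤ
  (A ⊛ B) n = sumToℤ n (λ k → + (n C k) * (A k * B (n ∸ k)))

  module _ (A B : ℕ → ℤ) where

    ⊛-congˡ : ∀ A′ n → (∀ k → A k ≡ A′ k) → (A ⊛ B) n ≡ (A′ ⊛ B) n
    ⊛-congˡ A′ n A≗A′ = sumToℤ-cong n (λ k _ → cong (λ x → + (n C k) * (x * B (n ∸ k))) (A≗A′ k))

    ⊛-congʳ : ∀ B′ n → (∀ k → B k ≡ B′ k) → (A ⊛ B) n ≡ (A ⊛ B′) n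
    ⊛-congʳ B′ n B≗B′ = sumToℤ-cong n (λ k _ → cong (λ x → + (n C k) * (A k * x)) (B≗B′ (n ∸ k)))

    ⊛-+ˡ : ∀ A′ n → ((λ k → A k + A′ k) ⊛ B) n ≡ (A ⊛ B) n + (A′ ⊛ B) n
    ⊛-+ˡ A′ n = trans (sumToℤ-cong n (λ k _ → distrib (+ (n C k)) (A k) (A′ k) (B (n ∸ k)))) (sumToℤ-+ n _ _)
      where
      distrib : ∀ c x y z → c * ((x + y) * z) ≡ c * (x * z) + c * (y * z)
      distrib = solve-∀

    ⊛-*ˡ : ∀ c n → ((λ k → c * A k) ⊛ B) n ≡ c * (A ⊛ B) n
    ⊛-*ˡ c n = trans (sumToℤ-cong n (λ k _ → swap (+ (n C k)) c (A k) (B (n ∸ k)))) (sumToℤ-*ˡ n c _)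
      where
      swap : ∀ b c x z → b * ((c * x) * z) ≡ c * (b * (x * z))
      swap = solve-∀

    ⊛-negʳ : ∀ n → (A ⊛ (λ k → - B k)) n ≡ - (A ⊛ B) n
    ⊛-negʳ n = trans (sumToℤ-cong n (λ k _ → pull (+ (n C k)) (A k) (B (n ∸ k))))
                     (trans (sumToℤ-*ˡ n (- + 1) _) (-1*i≡-i _))
      where
      pull : ∀ b x z → b * (x * - z) ≡ - + 1 * (b * (x * z))
      pull = solve-∀

    ⊛-leibniz : ∀ n → (A ⊛ B) (suc n) ≡ ((A ∘ suc) ⊛ B) n + (A ⊛ (B ∘ suc)) n
    ⊛-leibniz n = begin
      (A ⊛ B) (suc n)
        ≡⟨ sumToℤ-suc n T ⟩
      T 0 + sumToℤ n (T ∘ suc)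
        ≡⟨ cong (λ z → T 0 + z) (trans (sumToℤ-cong n (λ j _ → pascal j)) (sumToℤ-+ n _ _)) ⟩
      T 0 + (((A ∘ suc) ⊛ B) n + sumToℤ n (U ∘ suc))
        ≡⟨ exchange (T 0) (((A ∘ suc) ⊛ B) n) (sumToℤ n (U ∘ suc)) ⟩
      ((A ∘ suc) ⊛ B) n + (U 0 + sumToℤ n (U ∘ suc))
        ≡⟨ cong (λ z → ((A ∘ suc) ⊛ B) n + z) (sym (sumToℤ-suc n U)) ⟩
      ((A ∘ suc) ⊛ B) n + (sumToℤ n U + U (suc n))
        ≡⟨ cong (λ c → ((A ∘ suc) ⊛ B) n + (sumToℤ n U + + c * (A (suc n) * B (n ∸ n))))
                (k>n⇒nCk≡0 (n<1+n n)) ⟩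
      ((A ∘ suc) ⊛ B) n + (sumToℤ n U + 0ℤ)
        ≡⟨ cong (λ z → ((A ∘ suc) ⊛ B) n + z) (trans (+-identityʳ _) (sumToℤ-cong n shift)) ⟩
      ((A ∘ suc) ⊛ B) n + (A ⊛ (B ∘ suc)) n ∎
      where
      open ≡-Reasoning
      T U : ℕ → ℤ
      T k = + (suc n C k) * (A k * B (suc n ∸ k))
      U k = + (n C k) * (A k * B (suc n ∸ k))
      exchange : ∀ a b c → a + (b + c) ≡ b + (a + c)
      exchange = solve-∀
      pascal : ∀ j → T (suc j) ≡ + (n C j) * (A (suc j) * B (n ∸ j)) + U (suc j)
      pascal j = trans (cong (λ c → + c * (A (suc j) * B (n ∸ j))) (sym (nCk+nC[k+1]≡[n+1]C[k+1] n j)))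
                       (trans (cong (_* (A (suc j) * B (n ∸ j))) (pos-+ (n C j) (n C suc j)))
                              (*-distribʳ-+ (A (suc j) * B (n ∸ j)) (+ (n C j)) (+ (n C suc j))))
      shift : ∀ k → k ≤ n → U k ≡ + (n C k) * (A k * B (suc (n ∸ k)))
      shift k k≤n = cong (λ m → + (n C k) * (A k * B m)) (+-∸-assoc 1 k≤n)

  cosNum-suc : ∀ n → cosNum (suc n) ≡ - sinNum n
  cosNum-suc 0 = refl
  cosNum-suc 1 = refl
  cosNum-suc 2 = refl
  cosNum-suc 3 = refl
  cosNum-suc (suc (suc (suc (suc n)))) = cosNum-suc n

  sinNum-suc : ∀ n → sinNum (suc n) ≡ cosNum n
  sinNum-suc 0 = refl
  sinNum-suc 1 = refl
  sinNum-suc 2 = refl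
  sinNum-suc 3 = refl
  sinNum-suc (suc (suc (suc (suc n)))) = sinNum-suc n

  cos-sin cos+sin : ℕ → ℤ
  cos-sin n = cosNum n - sinNum n
  cos+sin n = cosNum n + sinNum n

  cos-sin-suc : ∀ n → cos-sin (suc n) ≡ - cos+sin n
  cos-sin-suc n rewrite cosNum-suc n | sinNum-suc n = identity (cosNum n) (sinNum n)
    where
    identity : ∀ c s → - s - c ≡ - (c + s)
    identity = solve-∀

  cos+sin-suc : ∀ n → cos+sin (suc n) ≡ cos-sin n
  cos+sin-suc n rewrite cosNum-suc n | sinNum-suc n = identity (cosNum n) (sinNum n)
    where
    identity : ∀ c s → - s + c ≡ c - s
    identity = solve-∀

  F : ℕ → ℕ → ℤ
  F d n = + completions n d

  F-suc : ∀ d n → F d (suc n) ≡ F (suc d) n + (+ 1 + + 2 * + d) * F d n + + 2 * + d * + d * F (d ∸ 1) n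
  F-suc d n = cong₂ (λ u v → F (suc d) n + u + v)
    (trans (pos-* (1 ℕ.+ 2 ℕ.* d) (completions n d)) (cong (λ w → (+ 1 + w) * F d n) (pos-* 2 d)))
    (trans (pos-* (2 ℕ.* d ℕ.* d) (completions n (d ∸ 1)))
           (cong (_* F (d ∸ 1) n) (trans (pos-* (2 ℕ.* d) d) (cong (_* + d) (pos-* 2 d)))))

  F-⊛-suc : ∀ d B n → (F d ⊛ B) (suc n) ≡ (F (suc d) ⊛ B) n + (+ 1 + + 2 * + d) * (F d ⊛ B) n
                                          + + 2 * + d * + d * (F (d ∸ 1) ⊛ B) n + (F d ⊛ (B ∘ suc)) n
  F-⊛-suc d B n = trans (⊛-leibniz (F d) B n) (cong (_+ (F d ⊛ (B ∘ suc)) n) expand)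
    where
    c₁ c₂ : ℤ
    c₁ = + 1 + + 2 * + d
    c₂ = + 2 * + d * + d
    expand : ((F d ∘ suc) ⊛ B) n ≡ (F (suc d) ⊛ B) n + c₁ * (F d ⊛ B) n + c₂ * (F (d ∸ 1) ⊛ B) n
    expand =
      trans (⊛-congˡ (F d ∘ suc) B _ n (F-suc d))
      (trans (⊛-+ˡ (λ k → F (suc d) k + c₁ * F d k) B (λ k → c₂ * F (d ∸ 1) k) n)
             (cong₂ _+_ (trans (⊛-+ˡ (F (suc d)) B (λ k → c₁ * F d k) n)
                               (cong (λ z → (F (suc d) ⊛ B) n + z) (⊛-*ˡ (F d) B c₁ n)))
                        (⊛-*ˡ (F (d ∸ 1)) B c₂ n)))

  N P : ℕ → ℕ → ℤ
  N d = F d ⊛ cos-sin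
  P d = F d ⊛ cos+sin

  N-suc : ∀ d n → N d (suc n) ≡ N (suc d) n + (+ 1 + + 2 * + d) * N d n + + 2 * + d * + d * N (d ∸ 1) n - P d n
  N-suc d n =
    trans (F-⊛-suc d cos-sin n)
          (cong (λ z → N (suc d) n + c₁ * N d n + c₂ * N (d ∸ 1) n + z)
                (trans (⊛-congʳ (F d) (cos-sin ∘ suc) (λ k → - cos+sin k) n cos-sin-suc) (⊛-negʳ (F d) cos+sin n)))
    where
    c₁ c₂ : ℤ
    c₁ = + 1 + + 2 * + d
    c₂ = + 2 * + d * + d

  P-suc : ∀ d n → P d (suc n) ≡ P (suc d) n + (+ 1 + + 2 * + d) * P d n + + 2 * + d * + d * P (d ∸ 1) n + N d n
  P-suc d n =
    trans (F-⊛-suc d cos+sin n)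
          (cong (λ z → P (suc d) n + c₁ * P d n + c₂ * P (d ∸ 1) n + z)
                (⊛-congʳ (F d) (cos+sin ∘ suc) cos-sin n cos+sin-suc))
    where
    c₁ c₂ : ℤ
    c₁ = + 1 + + 2 * + d
    c₂ = + 2 * + d * + d

  -- D d ≡ 0 says (1 + d) F_d ((cos + sin) - (cos - sin)) = F_{d+1} (cos - sin).
  D : ℕ → ℕ → ℤ
  D d n = (+ 1 + + d) * (P d n - N d n) - N (suc d) n

  D-initial : ∀ d → D d 0 ≡ 0ℤ
  D-initial d = identity (+ 1 + + d) (F d 0)
    where
    identity : ∀ c x → c * (+ 1 * (x * + 1) - + 1 * (x * + 1)) - 0ℤ ≡ 0ℤ
    identity = solve-∀

  D-suc : ∀ d n → D d (suc n) ≡ D (suc d) n + (+ 2 + + 2 * + d) * D d n + + 2 * + d * (+ 1 + + d) * D (d ∸ 1) n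
  D-suc zero n =
    trans (cong₂ (λ u v → + 1 * u - v) (cong₂ _-_ (P-suc 0 n) (N-suc 0 n)) (N-suc 1 n))
          (identity (N 0 n) (N 1 n) (N 2 n) (P 0 n) (P 1 n))
    where
    identity : ∀ n₀ n₁ n₂ p₀ p₁ →
      + 1 * ((p₁ + + 1 * p₀ + + 0 * p₀ + n₀) - (n₁ + + 1 * n₀ + + 0 * n₀ - p₀))
      - (n₂ + + 3 * n₁ + + 2 * n₀ - p₁)
      ≡ + 2 * (p₁ - n₁) - n₂ + + 2 * (+ 1 * (p₀ - n₀) - n₁) + + 0 * (+ 1 * (p₀ - n₀) - n₁)
    identity = solve-∀
  D-suc (suc d) n =
    trans (cong₂ (λ u v → (+ 2 + + d) * u - v) (cong₂ _-_ (P-suc (suc d) n) (N-suc (suc d) n))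
                 (N-suc (suc (suc d)) n))
          (identity (+ d) (N d n) (N (suc d) n) (N (suc (suc d)) n) (N (suc (suc (suc d))) n)
                    (P d n) (P (suc d) n) (P (suc (suc d)) n))
    where
    identity : ∀ δ n₀ n₁ n₂ n₃ p₀ p₁ p₂ →
      (+ 2 + δ) * ((p₂ + (+ 1 + + 2 * (+ 1 + δ)) * p₁ + + 2 * (+ 1 + δ) * (+ 1 + δ) * p₀ + n₁)
                  - (n₂ + (+ 1 + + 2 * (+ 1 + δ)) * n₁ + + 2 * (+ 1 + δ) * (+ 1 + δ) * n₀ - p₁))
      - (n₃ + (+ 1 + + 2 * (+ 2 + δ)) * n₂ + + 2 * (+ 2 + δ) * (+ 2 + δ) * n₁ - p₂)
      ≡ (+ 3 + δ) * (p₂ - n₂) - n₃ + (+ 2 + + 2 * (+ 1 + δ)) * ((+ 2 + δ) * (p₁ - n₁) - n₂)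
        + + 2 * (+ 1 + δ) * (+ 2 + δ) * ((+ 1 + δ) * (p₀ - n₀) - n₁)
    identity = solve-∀

  D≡0 : ∀ n d → D d n ≡ 0ℤ
  D≡0 zero    d = D-initial d
  D≡0 (suc n) d = trans (D-suc d n) (vanishes (D≡0 n (suc d)) (D≡0 n d) (D≡0 n (d ∸ 1)))
    where
    vanishes : ∀ {x y z} → x ≡ 0ℤ → y ≡ 0ℤ → z ≡ 0ℤ →
               x + (+ 2 + + 2 * + d) * y + + 2 * + d * (+ 1 + + d) * z ≡ 0ℤ
    vanishes refl refl refl =
      cong₂ (λ u v → 0ℤ + u + v) (*-zeroʳ (+ 2 + + 2 * + d)) (*-zeroʳ (+ 2 * + d * (+ 1 + + d)))

  N₀-suc≡0 : ∀ n → N 0 (suc n) ≡ 0ℤ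
  N₀-suc≡0 n = trans (N-suc 0 n) (trans (identity (N 0 n) (N 1 n) (P 0 n)) (cong -_ (D≡0 n 0)))
    where
    identity : ∀ n₀ n₁ p₀ → n₁ + + 1 * n₀ + + 0 * n₀ - p₀ ≡ - (+ 1 * (p₀ - n₀) - n₁)
    identity = solve-∀

open Convolution

open import Data.Integer as ℤ using (ℤ; +_)
open import Data.Integer.Properties using (pos-*)
open import Data.Integer.Tactic.RingSolver using (solve-∀)
open import Data.Nat as ℕ using (zero; suc; _∸_; _≤_; z≤n; _!; NonZero)
open import Data.Nat.Combinatorics using (_C_; nCk≡n!/k![n-k]!; k![n∸k]!∣n!)
open import Data.Nat.DivMod using (m/n*n≡m)
open import Data.Nat.Properties using (_!≢0; _!*_!≢0; *-assoc; m≤n⇒m≤1+n; ≤-refl)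
open import Data.Rational as ℚ using (ℚ; _/_; fromℚᵘ)
open import Data.Rational.Properties
  using (fromℚᵘ-toℚᵘ; toℚᵘ-fromℚᵘ; fromℚᵘ-cong; toℚᵘ-homo-+; toℚᵘ-homo-*; toℚᵘ-homo‿-; 0/n≡0; /-cong)
open import Data.Rational.Unnormalised as ℚᵘ using (mkℚᵘ; *≡*)
open import Data.Rational.Unnormalised.Properties using (≃-trans; +-cong; *-cong; -‿cong)
open import Function using (_∘_)
open import Relation.Binary.PropositionalEquality using (refl; sym; trans; cong; cong₂; module ≡-Reasoning)

fromℚᵘ-+ : ∀ p q → fromℚᵘ (p ℚᵘ.+ q) ≡ fromℚᵘ p ℚ.+ fromℚᵘ q
fromℚᵘ-+ p q = sym (trans (sym (fromℚᵘ-toℚᵘ _))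
  (fromℚᵘ-cong (≃-trans (toℚᵘ-homo-+ (fromℚᵘ p) (fromℚᵘ q))
                        (+-cong (toℚᵘ-fromℚᵘ p) (toℚᵘ-fromℚᵘ q)))))

fromℚᵘ-* : ∀ p q → fromℚᵘ (p ℚᵘ.* q) ≡ fromℚᵘ p ℚ.* fromℚᵘ q
fromℚᵘ-* p q = sym (trans (sym (fromℚᵘ-toℚᵘ _))
  (fromℚᵘ-cong (≃-trans (toℚᵘ-homo-* (fromℚᵘ p) (fromℚᵘ q))
                        (*-cong (toℚᵘ-fromℚᵘ p) (toℚᵘ-fromℚᵘ q)))))

fromℚᵘ-neg : ∀ p → fromℚᵘ (ℚᵘ.- p) ≡ ℚ.- fromℚᵘ p
fromℚᵘ-neg p = sym (trans (sym (fromℚᵘ-toℚᵘ _))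
  (fromℚᵘ-cong (≃-trans (toℚᵘ-homo‿- (fromℚᵘ p)) (-‿cong (toℚᵘ-fromℚᵘ p)))))

/-+-/ : ∀ i j n .{{_ : NonZero n}} → i / n ℚ.+ j / n ≡ (i ℤ.+ j) / n
/-+-/ i j (suc m) = trans (sym (fromℚᵘ-+ (mkℚᵘ i m) (mkℚᵘ j m)))
                          (fromℚᵘ-cong (*≡* {mkℚᵘ i m ℚᵘ.+ mkℚᵘ j m} {mkℚᵘ (i ℤ.+ j) m} cross))
  where
  cross : (i ℤ.* + suc m ℤ.+ j ℤ.* + suc m) ℤ.* + suc m ≡ (i ℤ.+ j) ℤ.* + (suc m ℕ.* suc m)
  cross = identity i j (+ suc m)
    where
    identity : ∀ i j s → (i ℤ.* s ℤ.+ j ℤ.* s) ℤ.* s ≡ (i ℤ.+ j) ℤ.* (s ℤ.* s)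
    identity = solve-∀

/-−-/ : ∀ i j n .{{_ : NonZero n}} → i / n ℚ.- j / n ≡ (i ℤ.- j) / n
/-−-/ i j n@(suc m) = trans (cong (i / n ℚ.+_) (sym (fromℚᵘ-neg (mkℚᵘ j m)))) (/-+-/ i (ℤ.- j) n)

/-*-/ : ∀ i j c m n N .{{_ : NonZero m}} .{{_ : NonZero n}} .{{_ : NonZero N}} →
        c ℕ.* m ℕ.* n ≡ N → (i / m) ℚ.* (j / n) ≡ (+ c ℤ.* (i ℤ.* j)) / N
/-*-/ i j c (suc m) (suc n) (suc N) cmn≡N =
  trans (sym (fromℚᵘ-* (mkℚᵘ i m) (mkℚᵘ j n)))
        (fromℚᵘ-cong (*≡* {mkℚᵘ i m ℚᵘ.* mkℚᵘ j n} {mkℚᵘ (+ c ℤ.* (i ℤ.* j)) N} cross))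
  where
  cross : (i ℤ.* j) ℤ.* + suc N ≡ (+ c ℤ.* (i ℤ.* j)) ℤ.* + (suc m ℕ.* suc n)
  cross = begin
    (i ℤ.* j) ℤ.* + suc N                        ≡⟨ cong (λ x → (i ℤ.* j) ℤ.* + x) (sym cmn≡N) ⟩
    (i ℤ.* j) ℤ.* + (c ℕ.* suc m ℕ.* suc n)      ≡⟨ cong ((i ℤ.* j) ℤ.*_) (trans (pos-* (c ℕ.* suc m) (suc n))
                                                                          (cong (ℤ._* + suc n) (pos-* c (suc m)))) ⟩
    (i ℤ.* j) ℤ.* (+ c ℤ.* + suc m ℤ.* + suc n)  ≡⟨ identity (i ℤ.* j) (+ c) (+ suc m) (+ suc n) ⟩
    (+ c ℤ.* (i ℤ.* j)) ℤ.* (+ suc m ℤ.* + suc n) ∎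
    where
    open ≡-Reasoning
    identity : ∀ x c m n → x ℤ.* (c ℤ.* m ℤ.* n) ≡ (c ℤ.* x) ℤ.* (m ℤ.* n)
    identity = solve-∀

sumTo-cong : ∀ n {f g : ℕ → ℚ} → (∀ k → k ≤ n → f k ≡ g k) → sumTo n f ≡ sumTo n g
sumTo-cong zero    f≗g = f≗g 0 z≤n
sumTo-cong (suc n) f≗g =
  cong₂ ℚ._+_ (sumTo-cong n (λ k k≤n → f≗g k (m≤n⇒m≤1+n k≤n))) (f≗g (suc n) ≤-refl)

sumTo-/ : ∀ n (x : ℕ → ℤ) N .{{_ : NonZero N}} → sumTo n (λ k → x k / N) ≡ sumToℤ n x / N
sumTo-/ zero    x N = refl
sumTo-/ (suc n) x N = trans (cong (ℚ._+ (x (suc n) / N)) (sumTo-/ n x N)) (/-+-/ (sumToℤ n x) (x (suc n)) N)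

nCk*k!*[n∸k]!≡n! : ∀ {n k} → k ≤ n → (n C k) ℕ.* k ! ℕ.* (n ∸ k) ! ≡ n !
nCk*k!*[n∸k]!≡n! {n} {k} k≤n =
  trans (*-assoc (n C k) (k !) ((n ∸ k) !))
        (trans (cong (ℕ._* (k ! ℕ.* (n ∸ k) !)) (nCk≡n!/k![n-k]! k≤n)) (m/n*n≡m (k![n∸k]!∣n! k≤n)))
  where instance _ = k !* (n ∸ k) !≢0

egf-⋆-cosS⊖sinS : ∀ a n → (egf a ⋆ (cosS ⊖ sinS)) n ≡ (((+_ ∘ a) ⊛ cos-sin) n / n !) {{n !≢0}}
egf-⋆-cosS⊖sinS a n = trans (sumTo-cong n term) (sumTo-/ n _ (n !))
  where
  instance
    _ = n !≢0
  term : ∀ k → k ≤ n →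
         egf a k ℚ.* (cosS ⊖ sinS) (n ∸ k) ≡ (+ (n C k) ℤ.* (+ a k ℤ.* cos-sin (n ∸ k))) / n !
  term k k≤n = trans (cong (egf a k ℚ.*_) (/-−-/ (cosNum (n ∸ k)) (sinNum (n ∸ k)) ((n ∸ k) !)))
                     (/-*-/ (+ a k) (cos-sin (n ∸ k)) (n C k) (k !) ((n ∸ k) !) (n !) (nCk*k!*[n∸k]!≡n! k≤n))
    where instance
      _ = k !≢0
      _ = (n ∸ k) !≢0

N₀/n!≡oneS : ∀ n → (N 0 n / n !) {{n !≢0}} ≡ oneS n
N₀/n!≡oneS zero    = refl
N₀/n!≡oneS (suc n) = trans (/-cong (N₀-suc≡0 n) refl) (0/n≡0 (suc n !))
  where instance _ = suc n !≢0

theorem3p9 : (n : ℕ) → (egf WI ⋆ (cosS ⊖ sinS)) n ≡ oneS n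
theorem3p9 n = begin
  (egf WI ⋆ (cosS ⊖ sinS)) n
    ≡⟨ egf-⋆-cosS⊖sinS WI n ⟩
  ((+_ ∘ WI) ⊛ cos-sin) n / n !
    ≡⟨ /-cong (⊛-congˡ (+_ ∘ WI) cos-sin (F 0) n (cong +_ ∘ WI≡completions)) refl ⟩
  N 0 n / n !
    ≡⟨ N₀/n!≡oneS n ⟩
  oneS n ∎
  where
  open ≡-Reasoning
  instance _ = n !≢0
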